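{- Let $G$ be a strongly co-edge-regular graph with parameters $(n,k,2,\ell)$. Let $x$ be a vertex of $G$ and let $W:=\{w : w\sim x,\ a_{xw}\geqslant\frac{k}{2}\}$. If $W\neq\emptyset$, then $W$ induces a clique in $G$.
   Context: All graphs are finite, undirected and simple. A co-edge-regular graph with parameters $(n,k,c)$ is a $k$-regular graph on $n$ vertices, neither complete nor edgeless, in which any two distinct non-adjacent vertices have exactly $c$ common neighbours. For adjacent $x,y$, $a_{xy}$ is the number of common neighbours of $x,y$. A strongly co-edge-regular graph with parameters $(n,k,c,\ell)$ is a co-edge-regular graph with parameters $(n,k,c)$ such that for any two distinct non-adjacent vertices $x,z$, $\sum_{y\sim x,\,y\sim z}a_{xy}=\ell$. -}

module Defs where

open import Data.Nat using (ℕ; _+_; _*_; _≥_)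
open import Data.Bool using (Bool; true; false; if_then_else_; _∧_)
open import Data.Fin using (Fin)
open import Data.List using (List; map)
open import Data.Nat.ListAction using (sum)
open import Data.List.Base using (allFin)
open import Data.Product using (_×_; Σ; _,_)
open import Relation.Binary.PropositionalEquality using (_≡_; _≢_)
open import Relation.Nullary using (¬_)

record Graph (n : ℕ) : Set where
  field
    adj       : Fin n → Fin n → Bool
    symmetric : ∀ x y → adj x y ≡ adj y x
    irreflex  : ∀ x → adj x x ≡ false

module _ {n : ℕ} (G : Graph n) where
  open Graph G

  _∼_ : Fin n → Fin n → Set
  x ∼ y = adj x y ≡ true

  Σv : (Fin n → ℕ) → ℕ
  Σv f = sum (map f (allFin n))

  degree : Fin n → ℕ
  degree x = Σv (λ y → if adj x y then 1 else 0)

  common : Fin n → Fin n → ℕ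
  common x z = Σv (λ y → if adj x y ∧ adj y z then 1 else 0)

  a : Fin n → Fin n → ℕ
  a = common

  Regular : ℕ → Set
  Regular k = ∀ x → degree x ≡ k

  IsComplete : Set
  IsComplete = ∀ x y → x ≢ y → x ∼ y

  IsEdgeless : Set
  IsEdgeless = ∀ x y → ¬ (x ∼ y)

  CoEdgeRegular : ℕ → ℕ → Set
  CoEdgeRegular k c =
    Regular k × ¬ IsComplete × ¬ IsEdgeless ×
    (∀ x z → x ≢ z → ¬ (x ∼ z) → common x z ≡ c)

  StronglyCoEdgeRegular : ℕ → ℕ → ℕ → Set
  StronglyCoEdgeRegular k c ℓ =
    CoEdgeRegular k c ×
    (∀ x z → x ≢ z → ¬ (x ∼ z) →
       Σv (λ y → if adj x y ∧ adj y z then a x y else 0) ≡ ℓ)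

  -- W = { w : w ∼ x, a_{xw} ≥ k/2 }, membership predicate (2·a ≥ k ⇔ a ≥ k/2)
  InW : ℕ → Fin n → Fin n → Set
  InW k x w = w ∼ x × 2 * a x w ≥ k

{-# OPTIONS --safe #-}
-- If two vertices w, w′ of W were non-adjacent, count the neighbourhood of x: it contains
-- w, w′, the a_{xw} common neighbours of x and w and the a_{xw′} common neighbours of x and w′.
-- The last two families overlap only in common neighbours of w and w′, of which x itself is
-- one more, so a_{xw} + a_{xw′} + 3 ≤ k + c = k + 2, whereas a_{xw}, a_{xw′} ≥ k/2.
module Submission where

open import Defs
open import Data.Nat using (ℕ; zero; suc; _+_; _*_; _≤_; _<_; z≤n)
open import Data.Nat.Properties
  using ( ≤-refl; <⇒≱; +-identityʳ; +-comm; +-mono-≤; +-cancelˡ-≤; *-cancelˡ-≤; *-distribˡ-+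
        ; +-commutativeSemigroup; module ≤-Reasoning)
open import Data.Nat.ListAction using (sum)
open import Data.Bool using (Bool; true; false; if_then_else_; _∧_)
open import Data.Fin using (Fin; zero; suc)
open import Data.Fin.Properties using (_≟_)
open import Data.List using ([]; _∷_; map; tabulate; allFin)
open import Data.List.Properties using (map-tabulate)
open import Data.Product using (Σ; _,_)
open import Data.Empty using (⊥-elim)
open import Relation.Nullary using (does; yes; no; contradiction)
open import Relation.Nullary.Decidable using (dec-false)
open import Relation.Binary.PropositionalEquality
  using (_≡_; _≢_; refl; sym; trans; cong; cong₂; subst; subst₂; ≢-sym; module ≡-Reasoning)
open import Algebra.Properties.CommutativeSemigroup +-commutativeSemigroup using (interchange)

𝟙 : Bool → ℕ
𝟙 b = if b then 1 else 0

𝟙-∧-overlap : ∀ p q r → 𝟙 (p ∧ q) + 𝟙 (p ∧ r) ≤ 𝟙 p + 𝟙 (q ∧ r)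
𝟙-∧-overlap true  true  true  = ≤-refl
𝟙-∧-overlap true  true  false = ≤-refl
𝟙-∧-overlap true  false true  = ≤-refl
𝟙-∧-overlap true  false false = z≤n
𝟙-∧-overlap false _     _     = z≤n

module _ {A : Set} where

  sum-map-+ : ∀ (f g : A → ℕ) xs →
              sum (map (λ y → f y + g y) xs) ≡ sum (map f xs) + sum (map g xs)
  sum-map-+ f g []       = refl
  sum-map-+ f g (y ∷ xs) = trans (cong (f y + g y +_) (sum-map-+ f g xs))
                                 (interchange (f y) (g y) (sum (map f xs)) (sum (map g xs)))

  sum-map-mono : ∀ {f g : A → ℕ} → (∀ y → f y ≤ g y) → ∀ xs → sum (map f xs) ≤ sum (map g xs)
  sum-map-mono f≤g []       = z≤n
  sum-map-mono f≤g (y ∷ xs) = +-mono-≤ (f≤g y) (sum-map-mono f≤g xs)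

sum-tabulate-0 : ∀ n → sum (tabulate {n = n} (λ _ → 0)) ≡ 0
sum-tabulate-0 zero    = refl
sum-tabulate-0 (suc n) = sum-tabulate-0 n

sum-tabulate-𝟙-≟ : ∀ {n} (w : Fin n) → sum (tabulate (λ y → 𝟙 (does (y ≟ w)))) ≡ 1
sum-tabulate-𝟙-≟ {suc n} zero    = cong suc (sum-tabulate-0 n)
sum-tabulate-𝟙-≟ {suc n} (suc w) = sum-tabulate-𝟙-≟ {n} w

sum-allFin-𝟙-≟ : ∀ {n} (w : Fin n) → sum (map (λ y → 𝟙 (does (y ≟ w))) (allFin n)) ≡ 1
sum-allFin-𝟙-≟ {n} w = trans (cong sum (map-tabulate {n = n} (λ y → y) _)) (sum-tabulate-𝟙-≟ w)

k≤m+n : ∀ {k m n} → k ≤ 2 * m → k ≤ 2 * n → k ≤ m + n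
k≤m+n {k} {m} {n} k≤2m k≤2n = *-cancelˡ-≤ 2 (begin
  2 * k          ≡⟨ cong (k +_) (+-identityʳ k) ⟩
  k + k          ≤⟨ +-mono-≤ k≤2m k≤2n ⟩
  2 * m + 2 * n  ≡⟨ sym (*-distribˡ-+ 2 m n) ⟩
  2 * (m + n)    ∎)
  where open ≤-Reasoning

module _ {n : ℕ} (G : Graph n) where
  open Graph G

  adj⇒≢ : ∀ {u v} → adj u v ≡ true → u ≢ v
  adj⇒≢ {u} u∼u refl with () ← trans (sym (irreflex u)) u∼u

  module _ {x w w′ : Fin n} (w∼x : adj w x ≡ true) (w′∼x : adj w′ x ≡ true)
           (w≢w′ : w ≢ w′) (w≁w′ : adj w w′ ≡ false) where

    x∼w : adj x w ≡ true
    x∼w = trans (symmetric x w) w∼x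

    x∼w′ : adj x w′ ≡ true
    x∼w′ = trans (symmetric x w′) w′∼x

    w′≁w : adj w′ w ≡ false
    w′≁w = trans (symmetric w′ w) w≁w′

    count-at : ∀ y →
      𝟙 (does (y ≟ x)) + 𝟙 (does (y ≟ w)) + 𝟙 (does (y ≟ w′))
        + (𝟙 (adj x y ∧ adj y w) + 𝟙 (adj x y ∧ adj y w′))
      ≤ 𝟙 (adj x y) + 𝟙 (adj w y ∧ adj y w′)
    count-at y with y ≟ x
    ... | yes refl
      rewrite dec-false (x ≟ w) (≢-sym (adj⇒≢ w∼x)) | dec-false (x ≟ w′) (≢-sym (adj⇒≢ w′∼x))
            | irreflex x | w∼x | x∼w′ = ≤-refl
    ... | no _ with y ≟ w
    ... | yes refl rewrite dec-false (w ≟ w′) w≢w′ | x∼w | irreflex w | w≁w′ = ≤-refl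
    ... | no _ with y ≟ w′
    ... | yes refl rewrite x∼w′ | irreflex w′ | w′≁w | w≁w′ = ≤-refl
    ... | no _ rewrite symmetric w y = 𝟙-∧-overlap (adj x y) (adj y w) (adj y w′)

    3+a+a≤degree+common : 3 + (a G x w + a G x w′) ≤ degree G x + common G w w′
    3+a+a≤degree+common = subst₂ _≤_ lhs rhs (sum-map-mono count-at (allFin n))
      where
      open ≡-Reasoning
      three-points : Σv G (λ y → 𝟙 (does (y ≟ x)) + 𝟙 (does (y ≟ w)) + 𝟙 (does (y ≟ w′))) ≡ 3
      three-points = begin
        _ ≡⟨ sum-map-+ _ _ (allFin n) ⟩
        _ ≡⟨ cong (_+ _) (sum-map-+ _ _ (allFin n)) ⟩
        _ ≡⟨ cong₂ _+_ (cong₂ _+_ (sum-allFin-𝟙-≟ x) (sum-allFin-𝟙-≟ w)) (sum-allFin-𝟙-≟ w′) ⟩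
        3 ∎
      lhs : Σv G (λ y → 𝟙 (does (y ≟ x)) + 𝟙 (does (y ≟ w)) + 𝟙 (does (y ≟ w′))
                         + (𝟙 (adj x y ∧ adj y w) + 𝟙 (adj x y ∧ adj y w′)))
            ≡ 3 + (a G x w + a G x w′)
      lhs = trans (sum-map-+ _ _ (allFin n)) (cong₂ _+_ three-points (sum-map-+ _ _ (allFin n)))
      rhs : Σv G (λ y → 𝟙 (adj x y) + 𝟙 (adj w y ∧ adj y w′)) ≡ degree G x + common G w w′
      rhs = sum-map-+ _ _ (allFin n)

lemma3p3 : (n k ℓ : ℕ) (G : Graph n) → StronglyCoEdgeRegular G k 2 ℓ →
           (x : Fin n) → Σ (Fin n) (InW G k x) →
           ∀ w w′ → InW G k x w → InW G k x w′ → w ≢ w′ → _∼_ G w w′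
lemma3p3 n k ℓ G ((regular , _ , _ , co-edge) , _) x _ w w′ (w∼x , k≤2aw) (w′∼x , k≤2aw′) w≢w′
  with Graph.adj G w w′ in w≁w′
... | true  = refl
... | false = ⊥-elim (<⇒≱ a+a<k (k≤m+n {m = a G x w} {n = a G x w′} k≤2aw k≤2aw′))
  where
  counted : 3 + (a G x w + a G x w′) ≤ k + 2
  counted = subst₂ (λ d c → 3 + (a G x w + a G x w′) ≤ d + c)
                   (regular x) (co-edge w w′ w≢w′ (λ w∼w′ → contradiction (trans (sym w≁w′) w∼w′) λ ()))
                   (3+a+a≤degree+common G w∼x w′∼x w≢w′ w≁w′)
  a+a<k : a G x w + a G x w′ < k
  a+a<k = +-cancelˡ-≤ 2 _ _ (subst (3 + (a G x w + a G x w′) ≤_) (+-comm k 2) counted)
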